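{- Let $2\le m\le n$ be integers and let $G$ be a subgraph of the complete bipartite graph $K_{m,n}$ (with parts of sizes $m$ and $n$). Then there exist a tree $T$ with $m$ leaves and two families $F_1,F_2$ of subtrees of $T$ such that the intersection graph between $F_1$ and $F_2$ is isomorphic to $G$.
   Context: A subtree of a tree is a connected subgraph; families may contain repeated members. For two families $F_1,F_2$ of subtrees of $T$, the intersection graph between $F_1$ and $F_2$ is the bipartite graph with parts $F_1$ and $F_2$ in which $X\in F_1$ and $Y\in F_2$ are adjacent iff $X$ and $Y$ share a vertex. -}

module Defs where

open import Data.Nat using (ℕ; zero; suc; _≤_; _≟_)
open import Data.Fin using (Fin)
open import Data.Bool using (Bool; true; false; if_then_else_)
open import Data.List using (List; []; _∷_; _++_; length; map; filter; allFin)
open import Data.Nat.ListAction using (sum)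
open import Data.List.Relation.Unary.Unique.Propositional using (Unique)
open import Data.List.Relation.Unary.Linked using (Linked)
open import Data.Product using (Σ; _×_; ∃)
open import Data.Empty using (⊥)
open import Relation.Nullary using (¬_)
open import Relation.Binary.PropositionalEquality using (_≡_)
open import Function.Bundles using (_⤖_; Bijection)

data WalkIn {k : ℕ} (adj : Fin k → Fin k → Bool) (S : Fin k → Bool) : Fin k → Fin k → Set where
  here : ∀ {u} → S u ≡ true → WalkIn adj S u u
  step : ∀ {u v w} → S u ≡ true → adj u v ≡ true → WalkIn adj S v w → WalkIn adj S u w

Adj : {k : ℕ} → (Fin k → Fin k → Bool) → Fin k → Fin k → Set
Adj adj u v = adj u v ≡ true

ClosedChain : {k : ℕ} → (Fin k → Fin k → Bool) → List (Fin k) → Set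
ClosedChain adj [] = ⊥
ClosedChain adj (v ∷ vs) = Linked (Adj adj) (v ∷ vs ++ v ∷ [])

Cycle : {k : ℕ} → (Fin k → Fin k → Bool) → Set
Cycle {k} adj = Σ (List (Fin k)) λ vs → (3 ≤ length vs) × Unique vs × ClosedChain adj vs

allTrue : {k : ℕ} → Fin k → Bool
allTrue _ = true

record Tree (k : ℕ) : Set where
  field
    adj       : Fin k → Fin k → Bool
    symmetric : ∀ u v → adj u v ≡ adj v u
    irreflexive : ∀ u → adj u u ≡ false
    nonempty  : 1 ≤ k
    connected : ∀ u v → WalkIn adj allTrue u v
    acyclic   : ¬ Cycle adj

open Tree public

degree : {k : ℕ} → Tree k → Fin k → ℕ
degree {k} T u = sum (map (λ v → if adj T u v then 1 else 0) (allFin k))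

numLeaves : {k : ℕ} → Tree k → ℕ
numLeaves {k} T = length (filter (λ u → degree T u ≟ 1) (allFin k))

record Subtree {k : ℕ} (T : Tree k) : Set where
  field
    vs        : Fin k → Bool
    inhabited : ∃ λ u → vs u ≡ true
    connectedIn : ∀ u v → vs u ≡ true → vs v ≡ true → WalkIn (adj T) vs u v

open Subtree public

Meets : {k : ℕ} {T : Tree k} → Subtree T → Subtree T → Set
Meets {k} X Y = ∃ λ (v : Fin k) → (vs X v ≡ true) × (vs Y v ≡ true)

IsoBip : {m n p q : ℕ} → (Fin m → Fin n → Bool) → (Fin p → Fin q → Set) → Set
IsoBip {m} {n} {p} {q} G H =
  Σ (Fin m ⤖ Fin p) λ σ → Σ (Fin n ⤖ Fin q) λ τ →
    ∀ i j → ((G i j ≡ true) → H (Bijection.to σ i) (Bijection.to τ j))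
          × (H (Bijection.to σ i) (Bijection.to τ j) → G i j ≡ true)

-- Realise G on a star with centre 0 and leaves 1, …, m: the i-th subtree of the first family is
-- the leaf i alone, the j-th of the second is the centre together with the leaves i with G i j.
-- Every vertex set containing the centre is a subtree, and a singleton {v} meets a subtree X
-- exactly when v ∈ X, so the leaf i meets the j-th subtree of the second family iff G i j.
module Submission where

open import Defs
open import Data.Nat using (ℕ; zero; suc; _+_; _*_; _≤_; z≤n; s≤s)
import Data.Nat
open import Data.Nat.Properties using (*-zeroʳ; *-identityʳ; >⇒≢)
open import Data.Nat.ListAction using (sum)
open import Data.Fin using (Fin; zero; suc; _≟_)
open import Data.Bool using (Bool; true; false)
open import Data.List using (List; []; _∷_; length; map; filter; tabulate)
open import Data.List.Properties using (length-tabulate; filter-all; filter-reject)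
open import Data.List.Relation.Unary.All.Properties using (tabulate⁺)
open import Data.List.Relation.Unary.Linked using (_∷_)
open import Data.List.Relation.Unary.AllPairs using (_∷_)
open import Data.List.Relation.Unary.All using (_∷_)
open import Data.Product using (Σ; _×_; _,_)
open import Function using (_∘_; _⇔_; mk⇔; Equivalence)
open import Function.Construct.Identity using (⤖-id)
open import Relation.Nullary using (¬_; Dec; does; yes; no)
open import Relation.Nullary.Decidable using (dec-true)
open import Relation.Binary.PropositionalEquality using (_≡_; _≢_; refl; cong; cong₂; sym; trans)
open Relation.Binary.PropositionalEquality.≡-Reasoning

module _ {k : ℕ} (T : Tree k) where

  singleton : Fin k → Subtree T
  singleton v = record
    { vs          = λ u → does (u ≟ v)
    ; inhabited   = v , dec-true (v ≟ v) refl
    ; connectedIn = connected-singleton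
    }
    where
    member : ∀ u → does (u ≟ v) ≡ true → u ≡ v
    member u _ with u ≟ v
    member u _  | yes u≡v = u≡v
    member u () | no _

    connected-singleton : ∀ u w → does (u ≟ v) ≡ true → does (w ≟ v) ≡ true →
                          WalkIn (adj T) (λ x → does (x ≟ v)) u w
    connected-singleton u w u∈ w∈ with member u u∈ | member w w∈
    ... | refl | refl = here u∈

  meets-singleton : ∀ v (X : Subtree T) → Meets (singleton v) X ⇔ (vs X v ≡ true)
  meets-singleton v X = mk⇔ to (λ v∈X → v , dec-true (v ≟ v) refl , v∈X)
    where
    to : Meets (singleton v) X → vs X v ≡ true
    to (u , u∈ , u∈X) with u ≟ v | u∈
    ... | yes refl | _ = u∈X

starAdj : {m : ℕ} → Fin (suc m) → Fin (suc m) → Bool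
starAdj zero    zero    = false
starAdj zero    (suc _) = true
starAdj (suc _) zero    = true
starAdj (suc _) (suc _) = false

starAdj-sym : {m : ℕ} (u v : Fin (suc m)) → starAdj u v ≡ starAdj v u
starAdj-sym zero    zero    = refl
starAdj-sym zero    (suc _) = refl
starAdj-sym (suc _) zero    = refl
starAdj-sym (suc _) (suc _) = refl

starAdj-irrefl : {m : ℕ} (u : Fin (suc m)) → starAdj u u ≡ false
starAdj-irrefl zero    = refl
starAdj-irrefl (suc _) = refl

star-walk : {m : ℕ} (S : Fin (suc m) → Bool) → S zero ≡ true →
            ∀ u v → S u ≡ true → S v ≡ true → WalkIn starAdj S u v
star-walk S 0∈S u v u∈S v∈S = to-centre u u∈S (from-centre v v∈S)
  where
  from-centre : ∀ v → S v ≡ true → WalkIn starAdj S zero v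
  from-centre zero    v∈S = here v∈S
  from-centre (suc v) v∈S = step 0∈S refl (here v∈S)

  to-centre : ∀ u → S u ≡ true → WalkIn starAdj S zero v → WalkIn starAdj S u v
  to-centre zero    _   w = w
  to-centre (suc u) u∈S w = step u∈S refl w

-- Adjacent vertices of a star alternate between centre and leaves, so the first three or four
-- vertices of a cycle repeat one, contradicting uniqueness, or two consecutive ones are leaves.
star-acyclic : {m : ℕ} → ¬ Cycle (starAdj {m})
star-acyclic ([] , () , _)
star-acyclic (_ ∷ [] , s≤s () , _)
star-acyclic (_ ∷ _ ∷ [] , s≤s (s≤s ()) , _)
star-acyclic (zero ∷ zero ∷ _ ∷ _ , _ , _ , () ∷ _)
star-acyclic (zero ∷ suc _ ∷ zero ∷ _ , _ , (_ ∷ u≢w ∷ _) ∷ _ , _) = u≢w refl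
star-acyclic (zero ∷ suc _ ∷ suc _ ∷ _ , _ , _ , _ ∷ () ∷ _)
star-acyclic (suc _ ∷ suc _ ∷ _ ∷ _ , _ , _ , () ∷ _)
star-acyclic (suc _ ∷ zero ∷ zero ∷ _ , _ , _ , _ ∷ () ∷ _)
star-acyclic (suc _ ∷ zero ∷ suc _ ∷ [] , _ , _ , _ ∷ _ ∷ () ∷ _)
star-acyclic (suc _ ∷ zero ∷ suc _ ∷ suc _ ∷ _ , _ , _ , _ ∷ _ ∷ () ∷ _)
star-acyclic (suc _ ∷ zero ∷ suc _ ∷ zero ∷ _ , _ , _ ∷ (_ ∷ v≢x ∷ _) ∷ _ , _) = v≢x refl

star : (m : ℕ) → Tree (suc m)
star m = record
  { adj         = starAdj
  ; symmetric   = starAdj-sym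
  ; irreflexive = starAdj-irrefl
  ; nonempty    = s≤s z≤n
  ; connected   = λ u v → star-walk allTrue refl u v refl refl
  ; acyclic     = star-acyclic
  }

sum-map-tabulate-const : ∀ {a} {A : Set a} (n : ℕ) {g : Fin n → A} {f : A → ℕ} {c : ℕ} →
                         (∀ i → f (g i) ≡ c) → sum (map f (tabulate g)) ≡ n * c
sum-map-tabulate-const zero    _     = refl
sum-map-tabulate-const (suc n) f∘g≡c = cong₂ _+_ (f∘g≡c zero) (sum-map-tabulate-const n (f∘g≡c ∘ suc))

star-degree-centre : (m : ℕ) → degree (star m) zero ≡ m
star-degree-centre m = trans (sum-map-tabulate-const m (λ _ → refl)) (*-identityʳ m)

star-degree-leaf : (m : ℕ) (i : Fin m) → degree (star m) (suc i) ≡ 1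
star-degree-leaf m i = cong suc (trans (sum-map-tabulate-const m (λ _ → refl)) (*-zeroʳ m))

star-numLeaves : (m : ℕ) → m ≢ 1 → numLeaves (star m) ≡ m
star-numLeaves m m≢1 = begin
  length (filter P? (zero ∷ leaves)) ≡⟨ cong length (filter-reject P? {x = zero} (m≢1 ∘ centre≡)) ⟩
  length (filter P? leaves)          ≡⟨ cong length (filter-all P? (tabulate⁺ (star-degree-leaf m))) ⟩
  length leaves                      ≡⟨ length-tabulate suc ⟩
  m                                  ∎
  where
  leaves : List (Fin (suc m))
  leaves = tabulate suc

  P? : (u : Fin (suc m)) → Dec (degree (star m) u ≡ 1)
  P? u = degree (star m) u Data.Nat.≟ 1

  centre≡ : degree (star m) zero ≡ 1 → m ≡ 1
  centre≡ = trans (sym (star-degree-centre m))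

neighbourhood : {m n : ℕ} → (Fin m → Fin n → Bool) → Fin n → Fin (suc m) → Bool
neighbourhood G j zero    = true
neighbourhood G j (suc i) = G i j

starSubtree : {m : ℕ} (S : Fin (suc m) → Bool) → S zero ≡ true → Subtree (star m)
starSubtree S 0∈S = record
  { vs          = S
  ; inhabited   = zero , 0∈S
  ; connectedIn = star-walk S 0∈S
  }

lemma5p2 : (m n : ℕ) → 2 ≤ m → m ≤ n → (G : Fin m → Fin n → Bool) →
    Σ ℕ λ k → Σ (Tree k) λ T → (numLeaves T ≡ m) ×
      (Σ ℕ λ p → Σ ℕ λ q → Σ (Fin p → Subtree T) λ F₁ → Σ (Fin q → Subtree T) λ F₂ →
        IsoBip G (λ a b → Meets (F₁ a) (F₂ b)))
lemma5p2 m n 2≤m _ G =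
  suc m , star m , star-numLeaves m (>⇒≢ 2≤m) , m , n , F₁ , F₂ , ⤖-id (Fin m) , ⤖-id (Fin n) ,
  λ i j → let open Equivalence (meets-singleton (star m) (suc i) (F₂ j)) in from , to
  where
  F₁ : Fin m → Subtree (star m)
  F₁ = singleton (star m) ∘ suc

  F₂ : Fin n → Subtree (star m)
  F₂ j = starSubtree (neighbourhood G j) refl
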